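{- The ternary Thue–Morse sequence $\mathbf{vtm}$ is $3$-pseudoperiodic, but not $2$-pseudoperiodic.
   Context: The ternary (variant) Thue–Morse sequence $\mathbf{vtm}=210201\cdots$ is the infinite fixed point, starting with $2$, of the morphism $2\mapsto210$, $1\mapsto20$, $0\mapsto1$; it is indexed from $0$. For integers $k\ge1$ and $0<p_1<\cdots<p_k$, an infinite word $\mathbf{s}$ has pseudoperiod $(p_1,\ldots,p_k)$ if $\mathbf{s}[i]\in\{\mathbf{s}[i+p_1],\ldots,\mathbf{s}[i+p_k]\}$ for all $i\ge0$; it is $k$-pseudoperiodic if it has some pseudoperiod with exactly $k$ entries. -}

module Defs where

open import Data.Nat using (ℕ; zero; suc; _+_; _<_)
open import Data.Fin using (Fin; zero; suc)
open import Data.List using (List; []; _∷_; _++_; concatMap)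
open import Data.Vec using (Vec; lookup)
open import Data.Vec.Relation.Unary.Any using (Any)
open import Data.Product using (_×_; ∃)
open import Relation.Binary.PropositionalEquality using (_≡_)

Letter : Set
Letter = Fin 3

-- The morphism  2 ↦ 210,  1 ↦ 20,  0 ↦ 1.
μ : Letter → List Letter
μ zero             = suc zero ∷ []
μ (suc zero)       = suc (suc zero) ∷ zero ∷ []
μ (suc (suc zero)) = suc (suc zero) ∷ suc zero ∷ zero ∷ []

μ* : List Letter → List Letter
μ* = concatMap μ

iterate : ℕ → List Letter
iterate zero    = suc (suc zero) ∷ []
iterate (suc n) = μ* (iterate n)

-- i-th letter of a list (with a dummy default, never used below)
at : List Letter → ℕ → Letter
at []       _       = zero
at (x ∷ xs) zero    = x
at (x ∷ xs) (suc i) = at xs i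

-- The fixed point of μ starting with 2.  Each μ^n(2) is a prefix of
-- μ^(n+1)(2), and |μ^n(2)| ≥ n+1, so position i is read off μ^(i+1)(2).
vtm : ℕ → Letter
vtm i = at (iterate (suc i)) i

StrictPos : ∀ {k} → Vec ℕ k → Set
StrictPos {k} p = (∀ (j : Fin k) → 0 < lookup p j)
                × (∀ (j j' : Fin k) → Data.Fin._<_ j j' → lookup p j < lookup p j')

HasPseudoperiod : ∀ {k} → (ℕ → Letter) → Vec ℕ k → Set
HasPseudoperiod {k} s p = ∀ (i : ℕ) → Any (λ q → s i ≡ s (i + q)) p

Pseudoperiodic : ℕ → (ℕ → Letter) → Set
Pseudoperiodic k s = ∃ λ (p : Vec ℕ k) → StrictPos p × HasPseudoperiod s p

-- vtm is the first difference of the Thue–Morse word t: vtm[n] = t[n+1] − t[n] + 1.  Since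
-- t(2n) = t(n) and t(2n+1) = ¬t(n), the six bits t(m), t(m+1), t(m+a), t(m+a+1), t(m+b), t(m+b+1)
-- at (m, a, b) are a fixed function of those at (⌊m/2⌋, ⌊a/2⌋, ⌊b/2⌋) and of the last binary
-- digits of m, a, b.  Hence "a six-bit truth table holds at all (or some) m for the gaps a, b"
-- reduces to the same statement for another truth table and the halved gaps: an automaton
-- reading a and b least significant digit first.  Three such steps show that vtm[m] always
-- equals one of vtm[m+2], vtm[m+3], vtm[m+4].  For 0 < p < q, start from the table saying
-- vtm[m] ∉ {vtm[m+p], vtm[m+q]}; the finitely many reachable states (tables together with what
-- the digits read so far say about 0 < p < q) are computed, checked to be closed under the
-- transitions, and checked to be satisfiable once the digits run out.  Induction on the digits
-- of q then yields such an m for every candidate pseudoperiod (p, q).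

module Submission where

open import Algebra.Properties.CommutativeSemigroup using (interchange)
open import Data.Bool using (Bool; true; false; not; _∧_; _∨_; _xor_; T; T?; if_then_else_)
import Data.Bool.Properties as Bool
open import Data.Bool.Properties using (T-∧; T-∨)
open import Data.Empty using (⊥)
open import Data.Fin as Fin using (#_)
open import Data.Fin.Properties using (_≟_; all?)
open import Data.List using (List; []; _∷_; _++_; length; upTo)
open import Data.List.Properties using (length-++)
open import Data.List.Relation.Unary.All as All using (All)
open import Data.List.Relation.Unary.Any using (Any; any?; here; there; satisfied)
open import Data.Nat using (ℕ; zero; suc; _+_; _≤_; _<_; z≤n; s≤s; ⌊_/2⌋; _<?_)
open import Data.Nat.Properties
  using ( ≤-refl; ≤-trans; <-trans; <-≤-trans; ≤-pred; <⇒≤; n<1+n; m≤n⇒m≤1+n; m≤n⇒m<n∨m≡n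
        ; +-suc; +-identityʳ; +-mono-≤; +-cancelʳ-<; ⌊n/2⌋<n; ⌊n/2⌋-mono; +-commutativeSemigroup )
open import Data.Product using (_×_; _,_; ∃; proj₁; proj₂)
open import Data.Sum using (_⊎_; inj₁; inj₂)
open import Data.Vec using (Vec; []; _∷_; lookup)
import Data.Vec.Relation.Unary.Any as AnyV
open import Function using (_∘_)
open import Function.Bundles using (Equivalence)
open import Relation.Binary.Definitions using (DecidableEquality)
open import Relation.Binary.PropositionalEquality
  using (_≡_; _≢_; _≗_; refl; sym; trans; cong; cong₂; subst; subst₂; module ≡-Reasoning)
open import Relation.Nullary using (¬_)
open import Relation.Nullary.Decidable as Dec using (Dec; does; _×-dec_; _→-dec_)

open import Defs

double : ℕ → ℕ
double zero    = zero
double (suc n) = suc (suc (double n))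

bit : Bool → ℕ
bit false = 0
bit true  = 1

infixr 7 _∷₂_

_∷₂_ : Bool → ℕ → ℕ
b ∷₂ n = bit b + double n

∷₂-suc : ∀ b n → b ∷₂ suc n ≡ 2 + b ∷₂ n
∷₂-suc false n = refl
∷₂-suc true  n = refl

lsb : ℕ → Bool
lsb zero          = false
lsb (suc zero)    = true
lsb (suc (suc n)) = lsb n

lsb-∷₂ : ∀ b n → lsb (b ∷₂ n) ≡ b
lsb-∷₂ false zero    = refl
lsb-∷₂ true  zero    = refl
lsb-∷₂ false (suc n) = lsb-∷₂ false n
lsb-∷₂ true  (suc n) = lsb-∷₂ true n

⌊∷₂/2⌋ : ∀ b n → ⌊ b ∷₂ n /2⌋ ≡ n
⌊∷₂/2⌋ false zero    = refl
⌊∷₂/2⌋ true  zero    = refl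
⌊∷₂/2⌋ false (suc n) = cong suc (⌊∷₂/2⌋ false n)
⌊∷₂/2⌋ true  (suc n) = cong suc (⌊∷₂/2⌋ true n)

lsb∷₂⌊/2⌋ : ∀ n → lsb n ∷₂ ⌊ n /2⌋ ≡ n
lsb∷₂⌊/2⌋ zero          = refl
lsb∷₂⌊/2⌋ (suc zero)    = refl
lsb∷₂⌊/2⌋ (suc (suc n)) = trans (∷₂-suc (lsb n) ⌊ n /2⌋) (cong (2 +_) (lsb∷₂⌊/2⌋ n))

∷₂-injective : ∀ {p q a b} → p ∷₂ a ≡ q ∷₂ b → p ≡ q × a ≡ b
∷₂-injective {p} {q} {a} {b} eq =
  trans (sym (lsb-∷₂ p a)) (trans (cong lsb eq) (lsb-∷₂ q b)) ,
  trans (sym (⌊∷₂/2⌋ p a)) (trans (cong ⌊_/2⌋ eq) (⌊∷₂/2⌋ q b))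

∷₂-mono⁻¹-≤ : ∀ {p q a b} → p ∷₂ a ≤ q ∷₂ b → a ≤ b
∷₂-mono⁻¹-≤ {p} {q} {a} {b} le = subst₂ _≤_ (⌊∷₂/2⌋ p a) (⌊∷₂/2⌋ q b) (⌊n/2⌋-mono le)

∷₂-<-lex : ∀ {p q a b} → p ∷₂ a < q ∷₂ b → a < b ⊎ a ≡ b × p ≡ false × q ≡ true
∷₂-<-lex {p} {q} lt with m≤n⇒m<n∨m≡n (∷₂-mono⁻¹-≤ {p} {q} (<⇒≤ lt))
... | inj₁ a<b = inj₁ a<b
... | inj₂ refl = inj₂ (refl , bit-< p q (+-cancelʳ-< _ (bit p) (bit q) lt))
  where
  bit-< : ∀ p q → bit p < bit q → p ≡ false × q ≡ true
  bit-< false true _          = refl , refl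
  bit-< true  true  (s≤s ())

∷₂-positive : ∀ p a → 0 < p ∷₂ a → T p ⊎ 0 < a
∷₂-positive true  a       _ = inj₁ _
∷₂-positive false (suc a) _ = inj₂ (s≤s z≤n)

⌊/2⌋-≤-pred : ∀ {n f} → n ≤ suc f → ⌊ n /2⌋ ≤ f
⌊/2⌋-≤-pred {f = f} le = ≤-trans (⌊n/2⌋-mono le) (≤-pred (⌊n/2⌋<n f))

double-+ : ∀ m n → double (m + n) ≡ double m + double n
double-+ zero    n = refl
double-+ (suc m) n = cong (λ k → suc (suc k)) (double-+ m n)

∷₂+∷₂ : ∀ e p m a → e ∷₂ m + p ∷₂ a ≡ bit e + bit p + double (m + a)
∷₂+∷₂ e p m a =
  trans (interchange +-commutativeSemigroup (bit e) (double m) (bit p) (double a))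
        (cong (bit e + bit p +_) (sym (double-+ m a)))

thueMorseUpTo : ℕ → ℕ → Bool
thueMorseUpTo zero    n = false
thueMorseUpTo (suc f) n = lsb n xor thueMorseUpTo f ⌊ n /2⌋

thueMorse : ℕ → Bool
thueMorse n = thueMorseUpTo (suc n) n

thueMorseUpTo-0 : ∀ f → thueMorseUpTo f 0 ≡ false
thueMorseUpTo-0 zero    = refl
thueMorseUpTo-0 (suc f) = thueMorseUpTo-0 f

thueMorseUpTo-irrelevant : ∀ {f g} n → n < f → n < g → thueMorseUpTo f n ≡ thueMorseUpTo g n
thueMorseUpTo-irrelevant {suc f} {suc g} zero    _ _ = trans (thueMorseUpTo-0 f) (sym (thueMorseUpTo-0 g))
thueMorseUpTo-irrelevant {suc f} {suc g} (suc n) (s≤s n<f) (s≤s n<g) =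
  cong (lsb (suc n) xor_)
    (thueMorseUpTo-irrelevant ⌊ suc n /2⌋ (<-≤-trans (⌊n/2⌋<n n) n<f) (<-≤-trans (⌊n/2⌋<n n) n<g))

thueMorse-unfold : ∀ n → thueMorse n ≡ lsb n xor thueMorse ⌊ n /2⌋
thueMorse-unfold zero    = refl
thueMorse-unfold (suc n) =
  cong (lsb (suc n) xor_) (thueMorseUpTo-irrelevant ⌊ suc n /2⌋ (⌊n/2⌋<n n) (n<1+n _))

thueMorse-∷₂ : ∀ b n → thueMorse (b ∷₂ n) ≡ b xor thueMorse n
thueMorse-∷₂ b n =
  trans (thueMorse-unfold (b ∷₂ n)) (cong₂ (λ c k → c xor thueMorse k) (lsb-∷₂ b n) (⌊∷₂/2⌋ b n))

pairAt : ℕ → Bool × Bool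
pairAt n = thueMorse n , thueMorse (suc n)

pairAt-0∷₂ : ∀ c → pairAt (false ∷₂ c) ≡ (thueMorse c , not (thueMorse c))
pairAt-0∷₂ c = cong₂ _,_ (thueMorse-∷₂ false c) (thueMorse-∷₂ true c)

pairAt-1∷₂ : ∀ c → pairAt (true ∷₂ c) ≡ (not (thueMorse c) , thueMorse (suc c))
pairAt-1∷₂ c = cong₂ _,_ (thueMorse-∷₂ true c) (thueMorse-∷₂ false (suc c))

-- vtm as the difference sequence of Thue–Morse

diffLetter : Bool × Bool → Letter
diffLetter (false , true)  = # 2
diffLetter (true  , false) = # 0
diffLetter (false , false) = # 1
diffLetter (true  , true)  = # 1

Δ : ℕ → Letter
Δ n = diffLetter (pairAt n)

Δ-0∷₂ : ∀ k {u} → thueMorse k ≡ u → Δ (false ∷₂ k) ≡ diffLetter (u , not u)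
Δ-0∷₂ k refl = cong diffLetter (pairAt-0∷₂ k)

Δ-1∷₂ : ∀ k {u v} → thueMorse k ≡ u → thueMorse (suc k) ≡ v → Δ (true ∷₂ k) ≡ diffLetter (not u , v)
Δ-1∷₂ k refl refl = cong diffLetter (pairAt-1∷₂ k)

data FactorAt : ℕ → List Letter → Set where
  []  : ∀ {k} → FactorAt k []
  _∷_ : ∀ {k x w} → x ≡ Δ k → FactorAt (suc k) w → FactorAt k (x ∷ w)

-- |μ (Δ k)| = 2 + t(k+1) − t(k), so μ (Δ 0) ⋯ μ (Δ (k − 1)) has length 2k + t(k) (t(0) = 0).
imageStart : ℕ → ℕ
imageStart k = thueMorse k ∷₂ k

FactorAt-μ-letter : ∀ k {w} → FactorAt (imageStart (suc k)) w → FactorAt (imageStart k) (μ (Δ k) ++ w)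
FactorAt-μ-letter k rest with thueMorse k in tk | thueMorse (suc k) in tk′
... | false | true  = sym (Δ-0∷₂ k tk) ∷ sym (Δ-1∷₂ k tk tk′) ∷ sym (Δ-0∷₂ (suc k) tk′) ∷ rest
... | false | false = sym (Δ-0∷₂ k tk) ∷ sym (Δ-1∷₂ k tk tk′) ∷ rest
... | true  | true  = sym (Δ-1∷₂ k tk tk′) ∷ sym (Δ-0∷₂ (suc k) tk′) ∷ rest
... | true  | false = sym (Δ-1∷₂ k tk tk′) ∷ rest

FactorAt-μ* : ∀ {k w} → FactorAt k w → FactorAt (imageStart k) (μ* w)
FactorAt-μ* []             = []
FactorAt-μ* {k} (refl ∷ w) = FactorAt-μ-letter k (FactorAt-μ* w)

FactorAt-iterate : ∀ n → FactorAt 0 (iterate n)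
FactorAt-iterate zero    = refl ∷ []
FactorAt-iterate (suc n) = FactorAt-μ* (FactorAt-iterate n)

at-FactorAt : ∀ {k w} → FactorAt k w → ∀ j → j < length w → at w j ≡ Δ (k + j)
at-FactorAt {k} (x≡ ∷ _) zero    _         = trans x≡ (cong Δ (sym (+-identityʳ k)))
at-FactorAt {k} (_ ∷ w)  (suc j) (s≤s j<) = trans (at-FactorAt w j j<) (cong Δ (sym (+-suc k j)))

μ-nonempty : ∀ x → 1 ≤ length (μ x)
μ-nonempty Fin.zero                      = s≤s z≤n
μ-nonempty (Fin.suc Fin.zero)            = s≤s z≤n
μ-nonempty (Fin.suc (Fin.suc Fin.zero)) = s≤s z≤n

length-μ* : ∀ w → length w ≤ length (μ* w)
length-μ* []      = z≤n
length-μ* (x ∷ w) =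
  subst (1 + length w ≤_) (sym (length-++ (μ x))) (+-mono-≤ (μ-nonempty x) (length-μ* w))

iterate-head : ∀ n → ∃ λ w → iterate n ≡ # 2 ∷ w
iterate-head zero = [] , refl
iterate-head (suc n) with iterate-head n
... | w , eq rewrite eq = # 1 ∷ # 0 ∷ μ* w , refl

length-iterate : ∀ n → n < length (iterate n)
length-iterate zero = s≤s z≤n
length-iterate (suc n) with iterate-head n | length-iterate n
... | w , eq | n< rewrite eq = s≤s (s≤s (m≤n⇒m≤1+n (≤-trans (≤-pred n<) (length-μ* w))))

vtm≡Δ : ∀ i → vtm i ≡ Δ i
vtm≡Δ i = at-FactorAt (FactorAt-iterate (suc i)) i (<-trans (n<1+n i) (length-iterate (suc i)))

-- Truth tables of six-bit windows

_≡ᴸ_ : Letter → Letter → Bool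
x ≡ᴸ y = Dec.isYes (x ≟ y)

data Table : ℕ → Set where
  leaf : Bool → Table 0
  node : ∀ {n} → Table n → Table n → Table (suc n)

infix 25 _⟦_⟧

_⟦_⟧ : ∀ {n} → Table n → Vec Bool n → Bool
leaf b   ⟦ []        ⟧ = b
node f _ ⟦ false ∷ w ⟧ = f ⟦ w ⟧
node _ t ⟦ true  ∷ w ⟧ = t ⟦ w ⟧

table : ∀ {n} → (Vec Bool n → Bool) → Table n
table {zero}  f = leaf (f [])
table {suc n} f = node (table (λ w → f (false ∷ w))) (table (λ w → f (true ∷ w)))

⟦table⟧ : ∀ {n} (f : Vec Bool n → Bool) w → table f ⟦ w ⟧ ≡ f w
⟦table⟧ f []          = refl
⟦table⟧ f (false ∷ w) = ⟦table⟧ (λ w → f (false ∷ w)) w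
⟦table⟧ f (true  ∷ w) = ⟦table⟧ (λ w → f (true ∷ w)) w

infixr 5 _∷ᵖ_

_∷ᵖ_ : ∀ {n} → Bool × Bool → Vec Bool n → Vec Bool (2 + n)
(u , v) ∷ᵖ w = u ∷ v ∷ w

window : ℕ → ℕ → ℕ → Vec Bool 6
window m a b = pairAt m ∷ᵖ pairAt (m + a) ∷ᵖ pairAt (m + b) ∷ᵖ []

pairStep : Bool → Bool → Bool × Bool → Bool × Bool
pairStep false false (u , _) = u , not u
pairStep false true  (u , v) = not u , v
pairStep true  false (u , v) = not u , v
pairStep true  true  (_ , v) = v , not v

pairAt-∷₂+∷₂ : ∀ e p m a → pairAt (e ∷₂ m + p ∷₂ a) ≡ pairStep e p (pairAt (m + a))
pairAt-∷₂+∷₂ e p m a = trans (cong pairAt (∷₂+∷₂ e p m a)) (carry e p (m + a))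
  where
  carry : ∀ e p c → pairAt (bit e + bit p + double c) ≡ pairStep e p (pairAt c)
  carry false false c = pairAt-0∷₂ c
  carry false true  c = pairAt-1∷₂ c
  carry true  false c = pairAt-1∷₂ c
  carry true  true  c = pairAt-0∷₂ (suc c)

pairAt-∷₂ : ∀ e m → pairAt (e ∷₂ m) ≡ pairStep e false (pairAt m)
pairAt-∷₂ false m = pairAt-0∷₂ m
pairAt-∷₂ true  m = pairAt-1∷₂ m

windowStep : Bool → Bool → Bool → Vec Bool 6 → Vec Bool 6
windowStep e p q (x₀ ∷ x₁ ∷ y₀ ∷ y₁ ∷ z₀ ∷ z₁ ∷ []) =
  pairStep e false (x₀ , x₁) ∷ᵖ pairStep e p (y₀ , y₁) ∷ᵖ pairStep e q (z₀ , z₁) ∷ᵖ []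

window-∷₂ : ∀ e p q m a b → window (e ∷₂ m) (p ∷₂ a) (q ∷₂ b) ≡ windowStep e p q (window m a b)
window-∷₂ e p q m a b =
  cong₃ (λ x y z → x ∷ᵖ y ∷ᵖ z ∷ᵖ []) (pairAt-∷₂ e m) (pairAt-∷₂+∷₂ e p m a) (pairAt-∷₂+∷₂ e q m b)
  where
  cong₃ : ∀ {A B C D : Set} (f : A → B → C → D) {x x′ y y′ z z′} →
          x ≡ x′ → y ≡ y′ → z ≡ z′ → f x y z ≡ f x′ y′ z′
  cong₃ f refl refl refl = refl

halve : (Bool → Bool → Bool) → Bool → Bool → Table 6 → Table 6
halve _⊙_ p q S = table λ w → S ⟦ windowStep false p q w ⟧ ⊙ S ⟦ windowStep true p q w ⟧

⟦halve⟧ : ∀ _⊙_ p q S m a b → halve _⊙_ p q S ⟦ window m a b ⟧ ≡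
          S ⟦ window (false ∷₂ m) (p ∷₂ a) (q ∷₂ b) ⟧ ⊙ S ⟦ window (true ∷₂ m) (p ∷₂ a) (q ∷₂ b) ⟧
⟦halve⟧ _⊙_ p q S m a b = begin
  halve _⊙_ p q S ⟦ window m a b ⟧
    ≡⟨ ⟦table⟧ (λ w → S ⟦ windowStep false p q w ⟧ ⊙ S ⟦ windowStep true p q w ⟧) (window m a b) ⟩
  S ⟦ windowStep false p q (window m a b) ⟧ ⊙ S ⟦ windowStep true p q (window m a b) ⟧
    ≡⟨ sym (cong₂ (λ w w′ → S ⟦ w ⟧ ⊙ S ⟦ w′ ⟧)
                  (window-∷₂ false p q m a b) (window-∷₂ true p q m a b)) ⟩
  S ⟦ window (false ∷₂ m) (p ∷₂ a) (q ∷₂ b) ⟧ ⊙ S ⟦ window (true ∷₂ m) (p ∷₂ a) (q ∷₂ b) ⟧ ∎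
  where open ≡-Reasoning

Everywhere : Table 6 → ℕ → ℕ → Set
Everywhere S a b = ∀ m → T (S ⟦ window m a b ⟧)

Somewhere : Table 6 → ℕ → ℕ → Set
Somewhere S a b = ∃ λ m → T (S ⟦ window m a b ⟧)

everywhere-halve : ∀ {S} p q {a b} → Everywhere (halve _∧_ p q S) a b → Everywhere S (p ∷₂ a) (q ∷₂ b)
everywhere-halve {S} p q {a} {b} all m =
  subst (λ m → T (S ⟦ window m (p ∷₂ a) (q ∷₂ b) ⟧)) (lsb∷₂⌊/2⌋ m) (pick (lsb m))
  where
  both = Equivalence.to T-∧ (subst T (⟦halve⟧ _∧_ p q S ⌊ m /2⌋ a b) (all ⌊ m /2⌋))
  pick : ∀ e → T (S ⟦ window (e ∷₂ ⌊ m /2⌋) (p ∷₂ a) (q ∷₂ b) ⟧)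
  pick false = proj₁ both
  pick true  = proj₂ both

somewhere-halve : ∀ {S} p q {a b} → Somewhere (halve _∨_ p q S) a b → Somewhere S (p ∷₂ a) (q ∷₂ b)
somewhere-halve {S} p q {a} {b} (m , some)
  with Equivalence.to T-∨ (subst T (⟦halve⟧ _∨_ p q S m a b) some)
... | inj₁ here₀ = false ∷₂ m , here₀
... | inj₂ here₁ = true ∷₂ m , here₁

-- Pseudoperiod (2, 3, 4)

inPeriod234 : Vec Bool 6 → Bool
inPeriod234 (x₀ ∷ x₁ ∷ y₀ ∷ y₁ ∷ z₀ ∷ z₁ ∷ []) =
  x ≡ᴸ diffLetter (y₀ , y₁) ∨ x ≡ᴸ diffLetter (y₁ , z₀) ∨ x ≡ᴸ diffLetter (z₀ , z₁)
  where x = diffLetter (x₀ , x₁)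

everywhere-0-0 : ∀ {S} → (∀ u → T (S ⟦ u ∷ᵖ u ∷ᵖ u ∷ᵖ [] ⟧)) → Everywhere S 0 0
everywhere-0-0 {S} diag m =
  subst (λ k → T (S ⟦ pairAt m ∷ᵖ pairAt k ∷ᵖ pairAt k ∷ᵖ [] ⟧)) (sym (+-identityʳ m)) (diag (pairAt m))

everywhere-inPeriod234 : Everywhere (table inPeriod234) 2 4
everywhere-inPeriod234 =
  everywhere-halve {P} false false {1} {2}
    (everywhere-halve {P₁} true false {0} {1}
      (everywhere-halve {P₂} false true {0} {0} (everywhere-0-0 {P₃} diag)))
  where
  P = table inPeriod234
  P₁ = halve _∧_ false false P
  P₂ = halve _∧_ true false P₁
  P₃ = halve _∧_ false true P₂
  diag : ∀ u → T (P₃ ⟦ u ∷ᵖ u ∷ᵖ u ∷ᵖ [] ⟧)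
  diag (false , false) = _
  diag (false , true)  = _
  diag (true  , false) = _
  diag (true  , true)  = _

Δ-period234 : ∀ i → Δ i ≡ Δ (i + 2) ⊎ Δ i ≡ Δ (i + 3) ⊎ Δ i ≡ Δ (i + 4)
Δ-period234 i = letters (subst T (⟦table⟧ inPeriod234 (window i 2 4)) (everywhere-inPeriod234 i))
  where
  letters : T (inPeriod234 (window i 2 4)) → Δ i ≡ Δ (i + 2) ⊎ Δ i ≡ Δ (i + 3) ⊎ Δ i ≡ Δ (i + 4)
  letters h with Equivalence.to T-∨ h
  ... | inj₁ at2 = inj₁ (Dec.toWitness {a? = Δ i ≟ Δ (i + 2)} at2)
  ... | inj₂ rest with Equivalence.to T-∨ rest
  ... | inj₁ at3 = inj₂ (inj₁ (trans (Dec.toWitness at3) straddle))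
    where
    straddle : diffLetter (thueMorse (suc (i + 2)) , thueMorse (i + 4)) ≡ Δ (i + 3)
    straddle = cong₂ (λ j k → diffLetter (thueMorse j , thueMorse k)) (sym (+-suc i 2)) (+-suc i 3)
  ... | inj₂ at4 = inj₂ (inj₂ (Dec.toWitness {a? = Δ i ≟ Δ (i + 4)} at4))

-- No pseudoperiod of length 2

≟-Table : ∀ {n} → DecidableEquality (Table n)
≟-Table (leaf a)   (leaf b)     = Dec.map′ (cong leaf) (λ { refl → refl }) (a Bool.≟ b)
≟-Table (node f t) (node f′ t′) =
  Dec.map′ (λ { (refl , refl) → refl }) (λ { refl → refl , refl }) (≟-Table f f′ ×-dec ≟-Table t t′)

-- After reading the k low digits of p = p′ + 2ᵏa and q = q′ + 2ᵏb, goal must hold at some m for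
-- the gaps (a, b), positive records p′ > 0 and below records p′ < q′.
record State : Set where
  constructor state
  field
    goal     : Table 6
    positive : Bool
    below    : Bool

open State

≟-State : DecidableEquality State
≟-State (state S x y) (state S′ x′ y′) =
  Dec.map′ (λ { (refl , refl , refl) → refl }) (λ { refl → refl , refl , refl })
    (≟-Table S S′ ×-dec x Bool.≟ x′ ×-dec y Bool.≟ y′)

open import Data.List.Membership.DecPropositional ≟-State using (_∈_; _∈?_)

Admissible : State → ℕ → ℕ → Set
Admissible s a b = (T (positive s) ⊎ 0 < a) × (a < b ⊎ a ≡ b × T (below s))

belowStep : Bool → Bool → Bool → Bool
belowStep l false false = l
belowStep _ false true  = true
belowStep _ true  false = false
belowStep l true  true  = l

step : State → Bool → Bool → State
step (state S x y) p q = state (halve _∨_ p q S) (x ∨ p) (belowStep y p q)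

successors : State → List State
successors s = step s false false ∷ step s false true ∷ step s true false ∷ step s true true ∷ []

step∈successors : ∀ s p q → step s p q ∈ successors s
step∈successors s false false = here refl
step∈successors s false true  = there (here refl)
step∈successors s true  false = there (there (here refl))
step∈successors s true  true  = there (there (there (here refl)))

ready : State → Bool
ready s = positive s ∧ below s

Accepts : Table 6 → Set
Accepts S = Any (λ m → T (S ⟦ window m 0 0 ⟧)) (upTo 6)

Closed : List State → Set
Closed L = All (λ s → All (_∈ L) (successors s) × (T (ready s) → Accepts (goal s))) L

closed? : ∀ L → Dec (Closed L)
closed? L = All.all? (λ s → All.all? (_∈? L) (successors s) ×-dec (T? (ready s) →-dec accepts? (goal s))) L
  where
  accepts? : ∀ S → Dec (Accepts S)
  accepts? S = any? (λ m → T? (S ⟦ window m 0 0 ⟧)) (upTo 6)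

explore : ℕ → List State → List State → List State
explore zero    seen _          = seen
explore (suc n) seen []         = seen
explore (suc n) seen (s ∷ todo) =
  if does (s ∈? seen) then explore n seen todo else explore n (s ∷ seen) (todo ++ successors s)

isolated : Vec Bool 6 → Bool
isolated (x₀ ∷ x₁ ∷ y₀ ∷ y₁ ∷ z₀ ∷ z₁ ∷ []) =
  not (diffLetter (x₀ , x₁) ≡ᴸ diffLetter (y₀ , y₁)) ∧ not (diffLetter (x₀ , x₁) ≡ᴸ diffLetter (z₀ , z₁))

initial : State
initial = state (table isolated) false false

reachable : List State
reachable = explore 200 [] (initial ∷ [])

-- Opaque, so that later uses never make the type checker re-run the search.
opaque
  closed : Closed reachable
  closed = Dec.toWitness {a? = closed? reachable} _

  initial∈reachable : initial ∈ reachable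
  initial∈reachable = Dec.toWitness {a? = initial ∈? reachable} _

belowStep-same : ∀ l p → belowStep l p p ≡ l
belowStep-same l false = refl
belowStep-same l true  = refl

admissible-step : ∀ s p q {a b} → Admissible s (p ∷₂ a) (q ∷₂ b) → Admissible (step s p q) a b
admissible-step (state S x y) p q {a} (pos , lt) = positive-step pos , below-step lt
  where
  positive-step : T x ⊎ 0 < p ∷₂ a → T (x ∨ p) ⊎ 0 < a
  positive-step (inj₁ tx) = inj₁ (Equivalence.from T-∨ (inj₁ tx))
  positive-step (inj₂ 0<) with ∷₂-positive p a 0<
  ... | inj₁ tp = inj₁ (Equivalence.from T-∨ (inj₂ tp))
  ... | inj₂ 0<a = inj₂ 0<a
  below-step : ∀ {b} → p ∷₂ a < q ∷₂ b ⊎ p ∷₂ a ≡ q ∷₂ b × T y → a < b ⊎ a ≡ b × T (belowStep y p q)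
  below-step (inj₁ lt) with ∷₂-<-lex {p} {q} lt
  ... | inj₁ a<b = inj₁ a<b
  ... | inj₂ (refl , refl , refl) = inj₂ (refl , _)
  below-step (inj₂ (eq , ty)) with ∷₂-injective {p} {q} eq
  ... | refl , a≡b = inj₂ (a≡b , subst T (sym (belowStep-same y p)) ty)

admissible-0 : ∀ s {a} → Admissible s a 0 → a ≡ 0 × T (ready s)
admissible-0 s (inj₁ pos , inj₂ (refl , bel)) = refl , Equivalence.from T-∧ (pos , bel)

module _ {L : List State} (closedL : Closed L) where

  somewhere : ∀ n {s a b} → b ≤ n → s ∈ L → Admissible s a b → Somewhere (goal s) a b
  somewhere zero {s} z≤n s∈L adm with admissible-0 s adm
  ... | refl , rdy = satisfied (proj₂ (All.lookup closedL s∈L) rdy)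
  somewhere (suc n) {s} {a} {b} b≤ s∈L adm =
    subst₂ (Somewhere (goal s)) (lsb∷₂⌊/2⌋ a) (lsb∷₂⌊/2⌋ b)
      (somewhere-halve {goal s} p q (somewhere n b′≤ next∈L adm′))
    where
    p = lsb a
    q = lsb b
    b′≤ : ⌊ b /2⌋ ≤ n
    b′≤ = ⌊/2⌋-≤-pred b≤
    next∈L : step s p q ∈ L
    next∈L = All.lookup (proj₁ (All.lookup closedL s∈L)) (step∈successors s p q)
    adm′ : Admissible (step s p q) ⌊ a /2⌋ ⌊ b /2⌋
    adm′ = admissible-step s p q (subst₂ (Admissible s) (sym (lsb∷₂⌊/2⌋ a)) (sym (lsb∷₂⌊/2⌋ b)) adm)

isolated-position : ∀ {p₁ p₂} → 0 < p₁ → p₁ < p₂ → ∃ λ m → Δ m ≢ Δ (m + p₁) × Δ m ≢ Δ (m + p₂)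
isolated-position {p₁} {p₂} 0<p₁ p₁<p₂ =
  separate (somewhere closed p₂ ≤-refl initial∈reachable (inj₂ 0<p₁ , inj₁ p₁<p₂))
  where
  separate : Somewhere (table isolated) p₁ p₂ → ∃ λ m → Δ m ≢ Δ (m + p₁) × Δ m ≢ Δ (m + p₂)
  separate (m , found) with Equivalence.to T-∧ (subst T (⟦table⟧ isolated (window m p₁ p₂)) found)
  ... | ≢₁ , ≢₂ =
    m , Dec.toWitnessFalse {a? = Δ m ≟ Δ (m + p₁)} ≢₁ , Dec.toWitnessFalse {a? = Δ m ≟ Δ (m + p₂)} ≢₂

strictPos? : ∀ {k} (p : Vec ℕ k) → Dec (StrictPos p)
strictPos? p =
  all? (λ j → 0 <? lookup p j) ×-dec
  all? (λ j → all? (λ j′ → (j Fin.<? j′) →-dec (lookup p j <? lookup p j′)))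

Pseudoperiodic-resp : ∀ {k s s′} → s ≗ s′ → Pseudoperiodic k s → Pseudoperiodic k s′
Pseudoperiodic-resp s≗s′ (p , strict , period) =
  p , strict , λ i → AnyV.map (λ e → trans (sym (s≗s′ i)) (trans e (s≗s′ _))) (period i)

pseudoperiodic-3-Δ : Pseudoperiodic 3 Δ
pseudoperiodic-3-Δ = (2 ∷ 3 ∷ 4 ∷ []) , Dec.toWitness {a? = strictPos? (2 ∷ 3 ∷ 4 ∷ [])} _ , period
  where
  period : HasPseudoperiod Δ (2 ∷ 3 ∷ 4 ∷ [])
  period i with Δ-period234 i
  ... | inj₁ e        = AnyV.here e
  ... | inj₂ (inj₁ e) = AnyV.there (AnyV.here e)
  ... | inj₂ (inj₂ e) = AnyV.there (AnyV.there (AnyV.here e))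

¬pseudoperiodic-2-Δ : ¬ Pseudoperiodic 2 Δ
¬pseudoperiodic-2-Δ ((p₁ ∷ p₂ ∷ []) , (positive , increasing) , period) =
  refute (isolated-position (positive Fin.zero) (increasing Fin.zero (Fin.suc Fin.zero) (s≤s z≤n)))
  where
  refute : ∃ (λ m → Δ m ≢ Δ (m + p₁) × Δ m ≢ Δ (m + p₂)) → ⊥
  refute (m , ≢₁ , ≢₂) with period m
  ... | AnyV.here e₁              = ≢₁ e₁
  ... | AnyV.there (AnyV.here e₂) = ≢₂ e₂

proposition22 : Pseudoperiodic 3 vtm × ¬ Pseudoperiodic 2 vtm
proposition22 =
  Pseudoperiodic-resp (sym ∘ vtm≡Δ) pseudoperiodic-3-Δ ,
  ¬pseudoperiodic-2-Δ ∘ Pseudoperiodic-resp vtm≡Δ
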